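{- Let $q$ be a power of an odd prime and let $A,B,C,D,E\in \mathbb{F}_q$, not all zero. Consider $$f_{E,A,B,C,D}(X) = EX^2+AX^{q+1}+BX^{q^2+1}+CX^{2q}+DX^{2q^2}\in \mathbb{F}_q[X].$$ Then $f_{E,A,B,C,D}$ is planar over $\mathbb{F}_{q^3}$ if and only if \begin{align*} &(-2A^2D + 2ABE - 2B^2C)(\epsilon^3 + \epsilon^{3q} + \epsilon^{3q^2})\\ &+(2A^2C - 2ABD - 4ACD + 4AE^2 + 2B^2E - 4BCE + 4BD^2)(\epsilon^{2+q} + \epsilon^{1+2q^2} + \epsilon^{2q+q^2})\\ &+(2A^2E - 2ABC + 4AC^2 - 4ADE + 2B^2D - 4BCD + 4BE^2)(\epsilon^{2+q^2} + \epsilon^{1+2q} + \epsilon^{q+2q^2})\\ &+(2A^3 + 2B^3 + 8C^3 - 24CDE + 8D^3 + 8E^3)\epsilon^{1+q+q^2} \neq 0 \end{align*} for every $\epsilon\in \mathbb{F}_{q^3}^*$.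
   Context: For $q$ odd, a function $f:\mathbb{F}_{q^n}\to\mathbb{F}_{q^n}$ is called planar (over $\mathbb{F}_{q^n}$) if for every $\epsilon\in\mathbb{F}_{q^n}^*$ the polynomial $f(X+\epsilon)-f(X)$ induces a permutation of $\mathbb{F}_{q^n}$; a polynomial in $\mathbb{F}_q[X]$ is viewed as the function it induces on $\mathbb{F}_{q^n}$. -}

module Defs where

open import Level using (_⊔_)
import Algebra.Bundles
open Algebra.Bundles using (CommutativeRing)
open import Data.Nat using (ℕ) renaming (_*_ to _*ℕ_; _+_ to _+ℕ_)
open import Data.Fin using (Fin)
open import Data.Product using (_×_; Σ; ∃)
open import Relation.Binary.PropositionalEquality using (_≡_)
open import Relation.Nullary using (¬_)

module FF {c ℓ} (R : CommutativeRing c ℓ) where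
  open CommutativeRing R
  open import Algebra.Definitions.RawSemiring (Algebra.Bundles.Semiring.rawSemiring semiring)
    using (_^_) renaming (_×_ to _·_)

  IsField : Set (c ⊔ ℓ)
  IsField = (¬ (0# ≈ 1#)) × (∀ x → ¬ (x ≈ 0#) → ∃ λ y → (x * y) ≈ 1#)

  HasCard : ℕ → Set (c ⊔ ℓ)
  HasCard n = Σ (Fin n → Carrier) λ e →
    (∀ i j → e i ≈ e j → i ≡ j) × (∀ x → ∃ λ i → e i ≈ x)

  -- x lies in the subfield F_q = { x | x^q = x }.
  InSubfield : ℕ → Carrier → Set ℓ
  InSubfield q x = (x ^ q) ≈ x

  IsPermutation : (Carrier → Carrier) → Set (c ⊔ ℓ)
  IsPermutation g = (∀ x y → g x ≈ g y → x ≈ y) × (∀ y → ∃ λ x → g x ≈ y)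

  IsPlanar : (Carrier → Carrier) → Set (c ⊔ ℓ)
  IsPlanar f = ∀ ε → ¬ (ε ≈ 0#) → IsPermutation (λ x → f (x + ε) - f x)

  fEABCD : ℕ → (E A B C D : Carrier) → Carrier → Carrier
  fEABCD q E A B C D X =
    E * X ^ 2 + A * X ^ (q +ℕ 1) + B * X ^ (q *ℕ q +ℕ 1)
      + C * X ^ (2 *ℕ q) + D * X ^ (2 *ℕ (q *ℕ q))

  Expr : ℕ → (E A B C D : Carrier) → Carrier → Carrier
  Expr q E A B C D ε =
      ((- (2 · (A ^ 2 * D))) + 2 · (A * B * E) - 2 · (B ^ 2 * C))
        * (ε ^ 3 + ε ^ (3 *ℕ q) + ε ^ (3 *ℕ (q *ℕ q)))
    + (2 · (A ^ 2 * C) - 2 · (A * B * D) - 4 · (A * C * D) + 4 · (A * E ^ 2)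
         + 2 · (B ^ 2 * E) - 4 · (B * C * E) + 4 · (B * D ^ 2))
        * (ε ^ (2 +ℕ q) + ε ^ (1 +ℕ 2 *ℕ (q *ℕ q)) + ε ^ (2 *ℕ q +ℕ q *ℕ q))
    + (2 · (A ^ 2 * E) - 2 · (A * B * C) + 4 · (A * C ^ 2) - 4 · (A * D * E)
         + 2 · (B ^ 2 * D) - 4 · (B * C * D) + 4 · (B * E ^ 2))
        * (ε ^ (2 +ℕ q *ℕ q) + ε ^ (1 +ℕ 2 *ℕ q) + ε ^ (q +ℕ 2 *ℕ (q *ℕ q)))
    + (2 · (A ^ 3) + 2 · (B ^ 3) + 8 · (C ^ 3) - 24 · (C * D * E) + 8 · (D ^ 3)
         + 8 · (E ^ 3))
        * ε ^ (1 +ℕ q +ℕ q *ℕ q)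

  NotAllZero : (E A B C D : Carrier) → Set ℓ
  NotAllZero E A B C D =
    ¬ ((A ≈ 0#) × (B ≈ 0#) × (C ≈ 0#) × (D ≈ 0#) × (E ≈ 0#))

{-# OPTIONS --safe #-}
-- Let σ x = x ^ q be the Frobenius of the field F with q³ elements: a ring automorphism with
-- σ³ = id that fixes A, …, E. Then f(X) = Q(X, σX, σ²X) for the quadratic form
-- Q(u, v, w) = E u² + A uv + B uw + C v² + D w², so f(x + ε) − f(x) = L_ε(x) + f(ε) for the
-- σ-linear map L_ε(z) = c₀ z + c₁ σz + c₂ σ²z. Thus f is planar iff every L_ε with ε ≠ 0 is
-- injective, i.e. iff the Dickson matrix of L_ε is nonsingular: it maps (z, σz, σ²z) to the orbit
-- of L_ε(z), so a zero of L_ε is a kernel vector; conversely, if L_ε is onto, the Dickson matrix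
-- times the matrix of orbits of preimages of 1, μ, μ² is the Vandermonde matrix of
-- (μ, σμ, σ²μ), which is invertible when σμ ≠ μ. The Dickson determinant, a polynomial in
-- ε, σε, σ²ε, expands to the expression of the statement.

module Submission where

open import Algebra.Bundles using (CommutativeRing; CommutativeMonoid)
import Algebra.Properties.CommutativeMonoid.Sum
open import Algebra.Bundles.Raw using (RawRing)
open import Algebra.Morphism.Structures using (module RingMorphisms)
open import Algebra.Solver.Ring.AlmostCommutativeRing
  using (fromCommutativeRing; _-Raw-AlmostCommutative⟶_)
open import Data.Empty using (⊥-elim)
open import Data.Fin as Fin using (Fin; zero; suc; #_; toℕ; punchOut)
import Data.Fin.Properties as Fin
open import Data.Fin.Permutation using (Permutation; permutation)
open import Data.Integer as ℤ using (ℤ; +_; -[1+_]; _⊖_)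
import Data.Integer.Properties as ℤ
open import Data.Maybe as Maybe using (Maybe)
open import Data.Nat as ℕ using (ℕ; zero; suc; _≤_; _<_; z≤n; s≤s; _∸_; _!)
import Data.Nat.Properties as ℕ
open import Data.Nat.Combinatorics using (nCn≡1; k![n∸k]!∣n!) renaming (_C_ to _choose_)
open import Data.Nat.Combinatorics.Specification using (nCk≡n!/k![n-k]!)
open import Data.Nat.Divisibility using (_∣_; divides; ∣⇒≤; ∣1⇒≡1; m∣m*n)
open import Data.Nat.DivMod using (m*[n/m]≡n)
open import Data.Nat.Primality using (Prime; ¬prime[1]; euclidsLemma; prime⇒nonZero; prime⇒nonTrivial)
open import Data.Product using (_,_; proj₁; proj₂; ∃)
open import Data.Sum using (inj₁; inj₂; [_,_]′)
open import Data.Vec.Functional using (Vector; []; _∷_; head; tail; replicate; zipWith; updateAt)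
open import Defs
open import Function using (_∘_; _⇔_; mk⇔)
open import Relation.Binary.Bundles using (Setoid)
open import Relation.Binary.PropositionalEquality as ≡ using (_≡_; _≢_)
open import Relation.Nullary using (¬_; Dec; yes; no)
open import Relation.Nullary.Decidable using (dec⇒maybe; map′)

-- The library's solvers for an arbitrary commutative ring take the ring itself as coefficients
-- and so cannot cancel numerals; the old solver instantiated at the canonical map ℤ → R can.
-- ⟦_⟧ℤ uses the optimised multiples so that ⟦ + 1 ⟧ℤ is 1# definitionally.
module IntegerRingSolver {c ℓ} (R : CommutativeRing c ℓ) where
  open CommutativeRing R
  open import Algebra.Properties.Semiring.Mult.TCOptimised semiring using (_×_; ×-homo-+; ×1-homo-*)
  open import Algebra.Properties.Ring ring using (-0#≈0#; -‿involutive; -‿distribˡ-*; -‿distribʳ-*)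
  open import Algebra.Properties.AbelianGroup +-abelianGroup using (⁻¹-∙-comm)
  open import Algebra.Properties.CommutativeSemigroup +-commutativeSemigroup using (interchange)
  open import Relation.Binary.Reasoning.Setoid setoid

  ⟦_⟧ℤ : ℤ → Carrier
  ⟦ + n ⟧ℤ = n × 1#
  ⟦ -[1+ n ] ⟧ℤ = - (suc n × 1#)

  ⟦-⟧ℤ : ∀ i → ⟦ ℤ.- i ⟧ℤ ≈ - ⟦ i ⟧ℤ
  ⟦-⟧ℤ (+ zero) = sym -0#≈0#
  ⟦-⟧ℤ (+ suc n) = refl
  ⟦-⟧ℤ -[1+ n ] = sym (-‿involutive _)

  ⟦⊖⟧ℤ : ∀ m n → ⟦ m ⊖ n ⟧ℤ ≈ m × 1# - n × 1#
  ⟦⊖⟧ℤ m zero = trans (sym (+-identityʳ _)) (+-congˡ (sym -0#≈0#))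
  ⟦⊖⟧ℤ zero (suc n) = sym (+-identityˡ _)
  ⟦⊖⟧ℤ (suc m) (suc n) = begin
    ⟦ suc m ⊖ suc n ⟧ℤ                ≡⟨ ≡.cong ⟦_⟧ℤ (ℤ.[1+m]⊖[1+n]≡m⊖n m n) ⟩
    ⟦ m ⊖ n ⟧ℤ                        ≈⟨ ⟦⊖⟧ℤ m n ⟩
    m × 1# - n × 1#                   ≈⟨ +-identityˡ _ ⟨
    0# + (m × 1# - n × 1#)            ≈⟨ +-congʳ (-‿inverseʳ 1#) ⟨
    (1# - 1#) + (m × 1# - n × 1#)     ≈⟨ interchange _ _ _ _ ⟩
    (1# + m × 1#) + (- 1# - n × 1#)   ≈⟨ +-congˡ (⁻¹-∙-comm _ _) ⟩
    (1# + m × 1#) - (1# + n × 1#)     ≈⟨ +-cong (×-homo-+ 1# 1 m) (-‿cong (×-homo-+ 1# 1 n)) ⟨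
    suc m × 1# - suc n × 1#           ∎

  ⟦+⟧ℤ : ∀ i j → ⟦ i ℤ.+ j ⟧ℤ ≈ ⟦ i ⟧ℤ + ⟦ j ⟧ℤ
  ⟦+⟧ℤ (+ m) (+ n) = ×-homo-+ 1# m n
  ⟦+⟧ℤ (+ m) -[1+ n ] = ⟦⊖⟧ℤ m (suc n)
  ⟦+⟧ℤ -[1+ m ] (+ n) = trans (⟦⊖⟧ℤ n (suc m)) (+-comm _ _)
  ⟦+⟧ℤ -[1+ m ] -[1+ n ] = begin
    - (suc (suc (m ℕ.+ n)) × 1#)      ≡⟨ ≡.cong (λ k → - (suc k × 1#)) (ℕ.+-suc m n) ⟨
    - ((suc m ℕ.+ suc n) × 1#)        ≈⟨ -‿cong (×-homo-+ 1# (suc m) (suc n)) ⟩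
    - (suc m × 1# + suc n × 1#)       ≈⟨ ⁻¹-∙-comm _ _ ⟨
    - (suc m × 1#) - suc n × 1#       ∎

  ⟦+*⟧ℤ : ∀ m j → ⟦ + m ℤ.* j ⟧ℤ ≈ m × 1# * ⟦ j ⟧ℤ
  ⟦+*⟧ℤ m (+ n) = begin
    ⟦ + m ℤ.* + n ⟧ℤ      ≡⟨ ≡.cong ⟦_⟧ℤ (ℤ.pos-* m n) ⟨
    (m ℕ.* n) × 1#        ≈⟨ ×1-homo-* m n ⟩
    m × 1# * n × 1#       ∎
  ⟦+*⟧ℤ m -[1+ n ] = begin
    ⟦ + m ℤ.* ℤ.- + suc n ⟧ℤ      ≡⟨ ≡.cong ⟦_⟧ℤ (ℤ.neg-distribʳ-* (+ m) (+ suc n)) ⟨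
    ⟦ ℤ.- (+ m ℤ.* + suc n) ⟧ℤ    ≈⟨ ⟦-⟧ℤ (+ m ℤ.* + suc n) ⟩
    - ⟦ + m ℤ.* + suc n ⟧ℤ        ≈⟨ -‿cong (⟦+*⟧ℤ m (+ suc n)) ⟩
    - (m × 1# * suc n × 1#)       ≈⟨ -‿distribʳ-* _ _ ⟩
    m × 1# * - (suc n × 1#)       ∎

  ⟦*⟧ℤ : ∀ i j → ⟦ i ℤ.* j ⟧ℤ ≈ ⟦ i ⟧ℤ * ⟦ j ⟧ℤ
  ⟦*⟧ℤ (+ m) j = ⟦+*⟧ℤ m j
  ⟦*⟧ℤ -[1+ m ] j = begin
    ⟦ ℤ.- + suc m ℤ.* j ⟧ℤ        ≡⟨ ≡.cong ⟦_⟧ℤ (ℤ.neg-distribˡ-* (+ suc m) j) ⟨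
    ⟦ ℤ.- (+ suc m ℤ.* j) ⟧ℤ      ≈⟨ ⟦-⟧ℤ (+ suc m ℤ.* j) ⟩
    - ⟦ + suc m ℤ.* j ⟧ℤ          ≈⟨ -‿cong (⟦+*⟧ℤ (suc m) j) ⟩
    - (suc m × 1# * ⟦ j ⟧ℤ)       ≈⟨ -‿distribˡ-* _ _ ⟩
    - (suc m × 1#) * ⟦ j ⟧ℤ       ∎

  ℤ⟶R : ℤ.+-*-rawRing -Raw-AlmostCommutative⟶ fromCommutativeRing R
  ℤ⟶R = record
    { ⟦_⟧ = ⟦_⟧ℤ ; +-homo = ⟦+⟧ℤ ; *-homo = ⟦*⟧ℤ ; -‿homo = ⟦-⟧ℤ
    ; 0-homo = refl ; 1-homo = refl }

  ≟⟦⟧ℤ : ∀ i j → Maybe (⟦ i ⟧ℤ ≈ ⟦ j ⟧ℤ)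
  ≟⟦⟧ℤ i j = Maybe.map (reflexive ∘ ≡.cong ⟦_⟧ℤ) (dec⇒maybe (i ℤ.≟ j))

  open import Algebra.Solver.Ring ℤ.+-*-rawRing (fromCommutativeRing R) ℤ⟶R ≟⟦⟧ℤ public

  -- The generic definitions below (det, quadratic, …) are instantiated both here and at R; the
  -- solver's semantics maps the first instance definitionally onto the second, so `solve`
  -- proves identities stated with them.
  polynomialRawRing : ℕ → RawRing _ _
  polynomialRawRing n = record
    { Carrier = Polynomial n ; _≈_ = _≡_ ; _+_ = _:+_ ; _*_ = _:*_ ; -_ = :-_
    ; 0# = con (+ 0) ; 1# = con (+ 1) }

rotate : ∀ {a} {A : Set a} → Vector A 3 → Vector A 3
rotate v = v (# 1) ∷ v (# 2) ∷ v (# 0) ∷ []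

module Matrix3 {a ℓ} (R : RawRing a ℓ) where
  open RawRing R
  open import Algebra.Definitions.RawSemiring rawSemiring using (_^_)

  infixl 6 _-_
  _-_ : Carrier → Carrier → Carrier
  x - y = x + - y

  Matrix : Set a
  Matrix = Vector (Vector Carrier 3) 3

  infixl 7 _∙_ _*ᵥ_ _*ₘ_

  _∙_ : Vector Carrier 3 → Vector Carrier 3 → Carrier
  u ∙ v = u (# 0) * v (# 0) + u (# 1) * v (# 1) + u (# 2) * v (# 2)

  _*ᵥ_ : Matrix → Vector Carrier 3 → Vector Carrier 3
  (M *ᵥ x) i = M i ∙ x

  _*ₘ_ : Matrix → Matrix → Matrix
  (M *ₘ N) i j = (M *ᵥ λ k → N k j) i

  det : Matrix → Carrier
  det M = M (# 0) (# 0) * (M (# 1) (# 1) * M (# 2) (# 2) - M (# 1) (# 2) * M (# 2) (# 1))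
        - M (# 0) (# 1) * (M (# 1) (# 0) * M (# 2) (# 2) - M (# 1) (# 2) * M (# 2) (# 0))
        + M (# 0) (# 2) * (M (# 1) (# 0) * M (# 2) (# 1) - M (# 1) (# 1) * M (# 2) (# 0))

  adjugateRow₀ : Matrix → Vector Carrier 3
  adjugateRow₀ M = (M (# 1) (# 1) * M (# 2) (# 2) - M (# 1) (# 2) * M (# 2) (# 1))
                 ∷ - (M (# 0) (# 1) * M (# 2) (# 2) - M (# 0) (# 2) * M (# 2) (# 1))
                 ∷ (M (# 0) (# 1) * M (# 1) (# 2) - M (# 0) (# 2) * M (# 1) (# 1)) ∷ []

  vandermonde : Vector Carrier 3 → Matrix
  vandermonde v i j = v i ^ toℕ j

  -- With c′ = σ ∘ c and c″ = σ² ∘ c, row i holds the coefficients of σⁱ(c₀ z + c₁ σz + c₂ σ²z)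
  -- with respect to z, σz, σ²z.
  dicksonMatrix : (c c′ c″ : Vector Carrier 3) → Matrix
  dicksonMatrix c c′ c″ = c ∷ rotate (rotate c′) ∷ rotate c″ ∷ []

module Matrix3Properties {c ℓ} (R : CommutativeRing c ℓ) where
  open CommutativeRing R hiding (zero)
  open Matrix3 rawRing hiding (_-_)
  open IntegerRingSolver R
  private module P {n} = Matrix3 (polynomialRawRing n)

  ∙-rotate : ∀ u v → u ∙ rotate v ≈ rotate (rotate u) ∙ v
  ∙-rotate u v = solve 6
    (λ u₀ u₁ u₂ v₀ v₁ v₂ →
      let u′ = u₀ ∷ u₁ ∷ u₂ ∷ []
          v′ = v₀ ∷ v₁ ∷ v₂ ∷ []
      in u′ P.∙ rotate v′ := rotate (rotate u′) P.∙ v′)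
    refl (u (# 0)) (u (# 1)) (u (# 2)) (v (# 0)) (v (# 1)) (v (# 2))

  ∙-zeroʳ : ∀ u {v} → (∀ i → v i ≈ 0#) → u ∙ v ≈ 0#
  ∙-zeroʳ u {v} v≈0 = begin
    u ∙ v                                                ≈⟨ +-cong (+-cong (*-congˡ (v≈0 (# 0))) (*-congˡ (v≈0 (# 1)))) (*-congˡ (v≈0 (# 2))) ⟩
    u (# 0) * 0# + u (# 1) * 0# + u (# 2) * 0#           ≈⟨ +-cong (+-cong (zeroʳ _) (zeroʳ _)) (zeroʳ _) ⟩
    0# + 0# + 0#                                         ≈⟨ trans (+-identityʳ _) (+-identityʳ _) ⟩
    0#                                                   ∎
    where open import Relation.Binary.Reasoning.Setoid setoid

  ∙-cong : ∀ {u u′ v v′} → (∀ i → u i ≈ u′ i) → (∀ i → v i ≈ v′ i) → u ∙ v ≈ u′ ∙ v′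
  ∙-cong u≈u′ v≈v′ = +-cong (+-cong (*-cong (u≈u′ (# 0)) (v≈v′ (# 0))) (*-cong (u≈u′ (# 1)) (v≈v′ (# 1))))
                            (*-cong (u≈u′ (# 2)) (v≈v′ (# 2)))

  ∙-distribˡ-- : ∀ u v w → u ∙ zipWith _-_ v w ≈ u ∙ v - u ∙ w
  ∙-distribˡ-- u v w = solve 9
    (λ u₀ u₁ u₂ v₀ v₁ v₂ w₀ w₁ w₂ →
      let u′ = u₀ ∷ u₁ ∷ u₂ ∷ []
          v′ = v₀ ∷ v₁ ∷ v₂ ∷ []
          w′ = w₀ ∷ w₁ ∷ w₂ ∷ []
      in u′ P.∙ zipWith _:-_ v′ w′ := (u′ P.∙ v′) :- (u′ P.∙ w′))
    refl (u (# 0)) (u (# 1)) (u (# 2)) (v (# 0)) (v (# 1)) (v (# 2)) (w (# 0)) (w (# 1)) (w (# 2))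

  rotate-cong : ∀ {u v : Vector Carrier 3} → (∀ i → u i ≈ v i) → ∀ i → rotate u i ≈ rotate v i
  rotate-cong u≈v zero = u≈v (# 1)
  rotate-cong u≈v (suc zero) = u≈v (# 2)
  rotate-cong u≈v (suc (suc zero)) = u≈v (# 0)

  dicksonMatrix-cong : ∀ {c d c′ d′ c″ d″} → (∀ i → c i ≈ d i) → (∀ i → c′ i ≈ d′ i) → (∀ i → c″ i ≈ d″ i) →
    ∀ i j → dicksonMatrix c c′ c″ i j ≈ dicksonMatrix d d′ d″ i j
  dicksonMatrix-cong c≈d c′≈d′ c″≈d″ zero = c≈d
  dicksonMatrix-cong c≈d c′≈d′ c″≈d″ (suc zero) = rotate-cong (rotate-cong c′≈d′)
  dicksonMatrix-cong c≈d c′≈d′ c″≈d″ (suc (suc zero)) = rotate-cong c″≈d″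

  det-cong : ∀ {M N} → (∀ i j → M i j ≈ N i j) → det M ≈ det N
  det-cong M≈N = +-cong (+-cong
      (*-cong (M≈N (# 0) (# 0)) (minor (M≈N (# 1) (# 1)) (M≈N (# 2) (# 2)) (M≈N (# 1) (# 2)) (M≈N (# 2) (# 1))))
      (-‿cong (*-cong (M≈N (# 0) (# 1)) (minor (M≈N (# 1) (# 0)) (M≈N (# 2) (# 2)) (M≈N (# 1) (# 2)) (M≈N (# 2) (# 0))))))
      (*-cong (M≈N (# 0) (# 2)) (minor (M≈N (# 1) (# 0)) (M≈N (# 2) (# 1)) (M≈N (# 1) (# 1)) (M≈N (# 2) (# 0))))
    where
    minor : ∀ {a a′ b b′ x x′ y y′} → a ≈ a′ → b ≈ b′ → x ≈ x′ → y ≈ y′ → a * b - x * y ≈ a′ * b′ - x′ * y′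
    minor a b x y = +-cong (*-cong a b) (-‿cong (*-cong x y))

  det-*ₘ : ∀ M N → det (M *ₘ N) ≈ det M * det N
  det-*ₘ M N = solve 18
    (λ m₀₀ m₀₁ m₀₂ m₁₀ m₁₁ m₁₂ m₂₀ m₂₁ m₂₂ n₀₀ n₀₁ n₀₂ n₁₀ n₁₁ n₁₂ n₂₀ n₂₁ n₂₂ →
      let M′ = (m₀₀ ∷ m₀₁ ∷ m₀₂ ∷ []) ∷ (m₁₀ ∷ m₁₁ ∷ m₁₂ ∷ []) ∷ (m₂₀ ∷ m₂₁ ∷ m₂₂ ∷ []) ∷ []
          N′ = (n₀₀ ∷ n₀₁ ∷ n₀₂ ∷ []) ∷ (n₁₀ ∷ n₁₁ ∷ n₁₂ ∷ []) ∷ (n₂₀ ∷ n₂₁ ∷ n₂₂ ∷ []) ∷ []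
      in P.det (M′ P.*ₘ N′) := P.det M′ :* P.det N′)
    refl
    (M (# 0) (# 0)) (M (# 0) (# 1)) (M (# 0) (# 2)) (M (# 1) (# 0)) (M (# 1) (# 1)) (M (# 1) (# 2))
    (M (# 2) (# 0)) (M (# 2) (# 1)) (M (# 2) (# 2))
    (N (# 0) (# 0)) (N (# 0) (# 1)) (N (# 0) (# 2)) (N (# 1) (# 0)) (N (# 1) (# 1)) (N (# 1) (# 2))
    (N (# 2) (# 0)) (N (# 2) (# 1)) (N (# 2) (# 2))

  det-vandermonde : ∀ v → det (vandermonde v) ≈ (v (# 1) - v (# 0)) * (v (# 2) - v (# 0)) * (v (# 2) - v (# 1))
  det-vandermonde v = solve 3
    (λ x y z → P.det (P.vandermonde (x ∷ y ∷ z ∷ [])) := (y :- x) :* (z :- x) :* (z :- y))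
    refl (v (# 0)) (v (# 1)) (v (# 2))

  adjugateRow₀-∙ : ∀ M x → adjugateRow₀ M ∙ (M *ᵥ x) ≈ det M * x (# 0)
  adjugateRow₀-∙ M x = solve 12
    (λ m₀₀ m₀₁ m₀₂ m₁₀ m₁₁ m₁₂ m₂₀ m₂₁ m₂₂ x₀ x₁ x₂ →
      let M′ = (m₀₀ ∷ m₀₁ ∷ m₀₂ ∷ []) ∷ (m₁₀ ∷ m₁₁ ∷ m₁₂ ∷ []) ∷ (m₂₀ ∷ m₂₁ ∷ m₂₂ ∷ []) ∷ []
      in P.adjugateRow₀ M′ P.∙ (M′ P.*ᵥ (x₀ ∷ x₁ ∷ x₂ ∷ [])) := P.det M′ :* x₀)
    refl
    (M (# 0) (# 0)) (M (# 0) (# 1)) (M (# 0) (# 2)) (M (# 1) (# 0)) (M (# 1) (# 1)) (M (# 1) (# 2))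
    (M (# 2) (# 0)) (M (# 2) (# 1)) (M (# 2) (# 2)) (x (# 0)) (x (# 1)) (x (# 2))

  det-kernel : ∀ M x → (∀ i → (M *ᵥ x) i ≈ 0#) → det M * x (# 0) ≈ 0#
  det-kernel M x Mx≈0 = trans (sym (adjugateRow₀-∙ M x)) (∙-zeroʳ (adjugateRow₀ M) Mx≈0)

module PlanarityPolynomials {a ℓ} (R : RawRing a ℓ) (E A B C D : RawRing.Carrier R) where
  open RawRing R
  open import Algebra.Definitions.RawSemiring rawSemiring using (_^_) renaming (_×_ to _·_)
  open Matrix3 R using (_-_)

  monomial : ℕ → ℕ → ℕ → Vector Carrier 3 → Carrier
  monomial i j k v = v (# 0) ^ i * v (# 1) ^ j * v (# 2) ^ k

  quadratic : Vector Carrier 3 → Carrier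
  quadratic v = E * monomial 2 0 0 v + A * monomial 1 1 0 v + B * monomial 1 0 1 v
              + C * monomial 0 2 0 v + D * monomial 0 0 2 v

  linearPart : Vector Carrier 3 → Vector Carrier 3
  linearPart v = (E + E) * v (# 0) + A * v (# 1) + B * v (# 2)
               ∷ A * v (# 0) + (C + C) * v (# 1)
               ∷ B * v (# 0) + (D + D) * v (# 2) ∷ []

  dicksonDeterminant : Vector Carrier 3 → Carrier
  dicksonDeterminant v =
      ((- (2 · (A ^ 2 * D))) + 2 · (A * B * E) - 2 · (B ^ 2 * C))
        * (monomial 3 0 0 v + monomial 0 3 0 v + monomial 0 0 3 v)
    + (2 · (A ^ 2 * C) - 2 · (A * B * D) - 4 · (A * C * D) + 4 · (A * E ^ 2)
         + 2 · (B ^ 2 * E) - 4 · (B * C * E) + 4 · (B * D ^ 2))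
        * (monomial 2 1 0 v + monomial 1 0 2 v + monomial 0 2 1 v)
    + (2 · (A ^ 2 * E) - 2 · (A * B * C) + 4 · (A * C ^ 2) - 4 · (A * D * E)
         + 2 · (B ^ 2 * D) - 4 · (B * C * D) + 4 · (B * E ^ 2))
        * (monomial 2 0 1 v + monomial 1 2 0 v + monomial 0 1 2 v)
    + (2 · (A ^ 3) + 2 · (B ^ 3) + 8 · (C ^ 3) - 24 · (C * D * E) + 8 · (D ^ 3)
         + 8 · (E ^ 3))
        * monomial 1 1 1 v

module PlanarityIdentities {c ℓ} (R : CommutativeRing c ℓ) (E A B C D : CommutativeRing.Carrier R) where
  open CommutativeRing R hiding (zero)
  open Matrix3 rawRing using (_∙_; det; dicksonMatrix)
  open PlanarityPolynomials rawRing E A B C D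
  open IntegerRingSolver R
  private
    module M {n} = Matrix3 (polynomialRawRing n)
    module P {n} = PlanarityPolynomials (polynomialRawRing n)

  open import Algebra.Properties.Semiring.Exp semiring using (^-congˡ)

  monomial-cong : ∀ i j k {u v} → (∀ l → u l ≈ v l) → monomial i j k u ≈ monomial i j k v
  monomial-cong i j k u≈v = *-cong (*-cong (^-congˡ i (u≈v (# 0))) (^-congˡ j (u≈v (# 1)))) (^-congˡ k (u≈v (# 2)))

  quadratic-cong : ∀ {u v} → (∀ l → u l ≈ v l) → quadratic u ≈ quadratic v
  quadratic-cong u≈v = +-cong (+-cong (+-cong (+-cong
    (*-congˡ (monomial-cong 2 0 0 u≈v)) (*-congˡ (monomial-cong 1 1 0 u≈v)))
    (*-congˡ (monomial-cong 1 0 1 u≈v))) (*-congˡ (monomial-cong 0 2 0 u≈v))) (*-congˡ (monomial-cong 0 0 2 u≈v))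

  linearPart-cong : ∀ {u v} → (∀ l → u l ≈ v l) → ∀ l → linearPart u l ≈ linearPart v l
  linearPart-cong u≈v zero = +-cong (+-cong (*-congˡ (u≈v (# 0))) (*-congˡ (u≈v (# 1)))) (*-congˡ (u≈v (# 2)))
  linearPart-cong u≈v (suc zero) = +-cong (*-congˡ (u≈v (# 0))) (*-congˡ (u≈v (# 1)))
  linearPart-cong u≈v (suc (suc zero)) = +-cong (*-congˡ (u≈v (# 0))) (*-congˡ (u≈v (# 2)))

  quadratic-difference : ∀ u v →
    quadratic (zipWith _+_ u v) - quadratic u ≈ linearPart v ∙ u + quadratic v
  quadratic-difference u v = solve 11
    (λ e a b c d u₀ u₁ u₂ v₀ v₁ v₂ →
      let u′ = u₀ ∷ u₁ ∷ u₂ ∷ []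
          v′ = v₀ ∷ v₁ ∷ v₂ ∷ []
      in P.quadratic e a b c d (zipWith _:+_ u′ v′) :- P.quadratic e a b c d u′
         := P.linearPart e a b c d v′ M.∙ u′ :+ P.quadratic e a b c d v′)
    refl E A B C D (u (# 0)) (u (# 1)) (u (# 2)) (v (# 0)) (v (# 1)) (v (# 2))

  det-dicksonMatrix-linearPart : ∀ v →
    det (dicksonMatrix (linearPart v) (linearPart (rotate v)) (linearPart (rotate (rotate v))))
      ≈ dicksonDeterminant v
  det-dicksonMatrix-linearPart v = solve 8
    (λ e a b c d v₀ v₁ v₂ →
      let v′ = v₀ ∷ v₁ ∷ v₂ ∷ []
          lp = P.linearPart e a b c d
      in M.det (M.dicksonMatrix (lp v′) (lp (rotate v′)) (lp (rotate (rotate v′))))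
         := P.dicksonDeterminant e a b c d v′)
    refl E A B C D (v (# 0)) (v (# 1)) (v (# 2))

module FieldProperties {c ℓ} (F : CommutativeRing c ℓ) (isField : FF.IsField F) where
  open CommutativeRing F hiding (zero)
  open import Algebra.Properties.Semiring.Exp semiring using (_^_)
  open import Relation.Binary.Reasoning.Setoid setoid
  open IntegerRingSolver F using (solve; _:=_; _:+_; _:*_; _:-_; con)

  1≉0 : 1# ≉ 0#
  1≉0 1≈0 = proj₁ isField (sym 1≈0)

  x≉0∧x*y≈0⇒y≈0 : ∀ {x y} → x ≉ 0# → x * y ≈ 0# → y ≈ 0#
  x≉0∧x*y≈0⇒y≈0 {x} {y} x≉0 x*y≈0 with proj₂ isField x x≉0
  ... | x⁻¹ , x*x⁻¹≈1 = begin
    y              ≈⟨ *-identityˡ y ⟨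
    1# * y         ≈⟨ *-congʳ x*x⁻¹≈1 ⟨
    x * x⁻¹ * y    ≈⟨ trans (*-congʳ (*-comm x x⁻¹)) (*-assoc x⁻¹ x y) ⟩
    x⁻¹ * (x * y)  ≈⟨ *-congˡ x*y≈0 ⟩
    x⁻¹ * 0#       ≈⟨ zeroʳ x⁻¹ ⟩
    0#             ∎

  x*y≉0 : ∀ {x y} → x ≉ 0# → y ≉ 0# → x * y ≉ 0#
  x*y≉0 x≉0 y≉0 x*y≈0 = y≉0 (x≉0∧x*y≈0⇒y≈0 x≉0 x*y≈0)

  x^n≉0 : ∀ {x} n → x ≉ 0# → x ^ n ≉ 0#
  x^n≉0 zero x≉0 = 1≉0
  x^n≉0 (suc n) x≉0 = x*y≉0 x≉0 (x^n≉0 n x≉0)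

  *-cancelˡ : ∀ {x y z} → x ≉ 0# → x * y ≈ x * z → y ≈ z
  *-cancelˡ {x} {y} {z} x≉0 x*y≈x*z = x∙y⁻¹≈ε⇒x≈y y z (x≉0∧x*y≈0⇒y≈0 x≉0 (begin
    x * (y - z)      ≈⟨ solve 3 (λ x y z → x :* (y :- z) := x :* y :- x :* z) refl x y z ⟩
    x * y - x * z    ≈⟨ x≈y⇒x∙y⁻¹≈ε x*y≈x*z ⟩
    0#               ∎))
    where open import Algebra.Properties.Group +-group using (x∙y⁻¹≈ε⇒x≈y; x≈y⇒x∙y⁻¹≈ε)

  evalMonic : ∀ {d} → Vector Carrier d → Carrier → Carrier
  evalMonic {zero} a x = 1#
  evalMonic {suc d} a x = head a + x * evalMonic (tail a) x

  quotientByRoot : ∀ {d} → Carrier → Vector Carrier (suc d) → Vector Carrier d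
  quotientByRoot {zero} r a = []
  quotientByRoot {suc d} r a = evalMonic (tail a) r ∷ quotientByRoot r (tail a)

  evalMonic-quotientByRoot : ∀ {d} r (a : Vector Carrier (suc d)) x →
    evalMonic a x ≈ (x - r) * evalMonic (quotientByRoot r a) x + evalMonic a r
  evalMonic-quotientByRoot {zero} r a x = solve 3
    (λ r a₀ x → a₀ :+ x :* con (+ 1) := (x :- r) :* con (+ 1) :+ (a₀ :+ r :* con (+ 1)))
    refl r (head a) x
  evalMonic-quotientByRoot {suc d} r a x = begin
    head a + x * evalMonic (tail a) x
      ≈⟨ +-congˡ (*-congˡ (evalMonic-quotientByRoot r (tail a) x)) ⟩
    head a + x * ((x - r) * evalMonic (quotientByRoot r (tail a)) x + evalMonic (tail a) r)
      ≈⟨ solve 5 (λ a₀ x r q t → a₀ :+ x :* ((x :- r) :* q :+ t) := (x :- r) :* (t :+ x :* q) :+ (a₀ :+ r :* t))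
           refl (head a) x r (evalMonic (quotientByRoot r (tail a)) x) (evalMonic (tail a) r) ⟩
    (x - r) * (evalMonic (tail a) r + x * evalMonic (quotientByRoot r (tail a)) x)
      + (head a + r * evalMonic (tail a) r)  ∎

  distinctRoots≤degree : ∀ {d m} (a : Vector Carrier d) (r : Fin m → Carrier) →
    (∀ i j → r i ≈ r j → i ≡ j) → (∀ i → evalMonic a (r i) ≈ 0#) → m ≤ d
  distinctRoots≤degree {m = zero} a r r-injective roots = z≤n
  distinctRoots≤degree {zero} {suc m} a r r-injective roots = ⊥-elim (1≉0 (roots zero))
  distinctRoots≤degree {suc d} {suc m} a r r-injective roots =
    s≤s (distinctRoots≤degree (quotientByRoot (r zero) a) (r ∘ suc)
          (λ i j → Fin.suc-injective ∘ r-injective (suc i) (suc j)) quotient-roots)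
    where
    open import Algebra.Properties.Group +-group using (x∙y⁻¹≈ε⇒x≈y)
    quotient-roots : ∀ i → evalMonic (quotientByRoot (r zero) a) (r (suc i)) ≈ 0#
    quotient-roots i = x≉0∧x*y≈0⇒y≈0 rᵢ-r₀≉0 (begin
      (r (suc i) - r zero) * evalMonic (quotientByRoot (r zero) a) (r (suc i))
        ≈⟨ +-identityʳ _ ⟨
      (r (suc i) - r zero) * evalMonic (quotientByRoot (r zero) a) (r (suc i)) + 0#
        ≈⟨ +-congˡ (roots zero) ⟨
      (r (suc i) - r zero) * evalMonic (quotientByRoot (r zero) a) (r (suc i)) + evalMonic a (r zero)
        ≈⟨ evalMonic-quotientByRoot (r zero) a (r (suc i)) ⟨
      evalMonic a (r (suc i))
        ≈⟨ roots (suc i) ⟩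
      0# ∎)
      where
      rᵢ-r₀≉0 : r (suc i) - r zero ≉ 0#
      rᵢ-r₀≉0 rᵢ-r₀≈0 with r-injective (suc i) zero (x∙y⁻¹≈ε⇒x≈y _ _ rᵢ-r₀≈0)
      ... | ()

Fin-injective⇒surjective : ∀ {n} (h : Fin n → Fin n) → (∀ {i j} → h i ≡ h j → i ≡ j) →
  ∀ j → ∃ λ i → h i ≡ j
Fin-injective⇒surjective {zero} h h-injective ()
Fin-injective⇒surjective {suc n} h h-injective j with Fin.any? (λ i → h i Fin.≟ j)
... | yes hit = hit
... | no missed = ⊥-elim (ℕ.<-irrefl ≡.refl (Fin.injective⇒≤ {f = λ i → punchOut (j≢h i)} punchOut-injective))
  where
  j≢h : ∀ i → j ≢ h i
  j≢h i j≡hᵢ = missed (i , ≡.sym j≡hᵢ)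
  punchOut-injective : ∀ {i i′} → punchOut (j≢h i) ≡ punchOut (j≢h i′) → i ≡ i′
  punchOut-injective eq = h-injective (Fin.punchOut-injective (j≢h _) (j≢h _) eq)

module FiniteSetoid {c ℓ} (S : Setoid c ℓ) {n} (enum : Fin n → Setoid.Carrier S)
  (enum-injective : ∀ i j → Setoid._≈_ S (enum i) (enum j) → i ≡ j)
  (enum-surjective : ∀ x → ∃ λ i → Setoid._≈_ S (enum i) x) where
  open Setoid S
  open import Relation.Binary.Reasoning.Setoid S

  index : Carrier → Fin n
  index x = proj₁ (enum-surjective x)

  enum-index : ∀ x → enum (index x) ≈ x
  enum-index x = proj₂ (enum-surjective x)

  index-unique : ∀ {x i} → enum i ≈ x → index x ≡ i
  index-unique {x} {i} enumᵢ≈x = enum-injective (index x) i (trans (enum-index x) (sym enumᵢ≈x))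

  _≟_ : ∀ x y → Dec (x ≈ y)
  x ≟ y = map′ (λ eq → trans (sym (enum-index x)) (trans (reflexive (≡.cong enum eq)) (enum-index y)))
               (λ x≈y → index-unique (trans (enum-index y) (sym x≈y)))
               (index x Fin.≟ index y)

  injective⇒surjective : (g : Carrier → Carrier) → (∀ {x y} → x ≈ y → g x ≈ g y) →
    (∀ x y → g x ≈ g y → x ≈ y) → ∀ y → ∃ λ x → g x ≈ y
  injective⇒surjective g g-cong g-injective y = enum i , (begin
    g (enum i)        ≈⟨ enum-index _ ⟨
    enum (h i)        ≡⟨ ≡.cong enum hᵢ≡index-y ⟩
    enum (index y)    ≈⟨ enum-index y ⟩
    y                 ∎)
    where
    h : Fin n → Fin n
    h = index ∘ g ∘ enum
    h-injective : ∀ {i j} → h i ≡ h j → i ≡ j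
    h-injective {i} {j} hᵢ≡hⱼ = enum-injective i j (g-injective _ _ (begin
      g (enum i)   ≈⟨ enum-index _ ⟨
      enum (h i)   ≡⟨ ≡.cong enum hᵢ≡hⱼ ⟩
      enum (h j)   ≈⟨ enum-index _ ⟩
      g (enum j)   ∎))
    i : Fin n
    i = proj₁ (Fin-injective⇒surjective h h-injective (index y))
    hᵢ≡index-y : h i ≡ index y
    hᵢ≡index-y = proj₂ (Fin-injective⇒surjective h h-injective (index y))

  module _ {m ℓm} (M : CommutativeMonoid m ℓm) where
    private module M = CommutativeMonoid M
    open import Algebra.Properties.CommutativeMonoid.Sum M using (sum; ∑-permute; sum-cong-≋)

    sum-reindex : (G : Carrier → M.Carrier) → (∀ {x y} → x ≈ y → G x M.≈ G y) →
      (φ ψ : Carrier → Carrier) → (∀ {x y} → x ≈ y → φ x ≈ φ y) → (∀ {x y} → x ≈ y → ψ x ≈ ψ y) →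
      (∀ x → φ (ψ x) ≈ x) → (∀ x → ψ (φ x) ≈ x) →
      sum (G ∘ φ ∘ enum) M.≈ sum (G ∘ enum)
    sum-reindex G G-cong φ ψ φ-cong ψ-cong φ∘ψ ψ∘φ =
      M.sym (M.trans (∑-permute (G ∘ enum) π) (sum-cong-≋ (λ i → G-cong (enum-index (φ (enum i))))))
      where
      π : Permutation n n
      π = permutation (λ i → index (φ (enum i))) (λ j → index (ψ (enum j)))
        (λ j → index-unique (sym (trans (φ-cong (enum-index (ψ (enum j)))) (φ∘ψ (enum j)))))
        (λ i → index-unique (sym (trans (ψ-cong (enum-index (φ (enum i)))) (ψ∘φ (enum i)))))

prime∤m! : ∀ {p m} → Prime p → m < p → ¬ p ∣ m !
prime∤m! {m = zero} p-prime _ p∣1 = ¬prime[1] (≡.subst Prime (∣1⇒≡1 p∣1) p-prime)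
prime∤m! {m = suc m} p-prime 1+m<p p∣[1+m]! with euclidsLemma (suc m) (m !) p-prime p∣[1+m]!
... | inj₁ p∣1+m = ℕ.<⇒≱ 1+m<p (∣⇒≤ p∣1+m)
... | inj₂ p∣m! = prime∤m! p-prime (ℕ.<-trans (ℕ.n<1+n m) 1+m<p) p∣m!

k![n∸k]!*nCk≡n! : ∀ {n k} → k ≤ n → k ! ℕ.* (n ∸ k) ! ℕ.* (n choose k) ≡ n !
k![n∸k]!*nCk≡n! {n} {k} k≤n = ≡.trans
  (≡.cong (k ! ℕ.* (n ∸ k) ! ℕ.*_) (nCk≡n!/k![n-k]! k≤n))
  (m*[n/m]≡n (k![n∸k]!∣n! k≤n))
  where
  instance
    k![n∸k]!≢0 : ℕ.NonZero (k ! ℕ.* (n ∸ k) !)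
    k![n∸k]!≢0 = k ℕ.!* (n ∸ k) !≢0

n∣n! : ∀ n .{{_ : ℕ.NonZero n}} → n ∣ n !
n∣n! (suc n) = m∣m*n (n !)

prime∣p-choose-k : ∀ {p k} → Prime p → 0 < k → k < p → p ∣ p choose k
prime∣p-choose-k {p} {k} p-prime 0<k k<p =
  [ ⊥-elim ∘ p∤k![p∸k]! , (λ p∣pCk → p∣pCk) ]′ (euclidsLemma _ _ p-prime p∣k![p∸k]!*pCk)
  where
  instance
    p≢0 : ℕ.NonZero p
    p≢0 = prime⇒nonZero p-prime
  p∣k![p∸k]!*pCk : p ∣ k ! ℕ.* (p ∸ k) ! ℕ.* (p choose k)
  p∣k![p∸k]!*pCk = ≡.subst (p ∣_) (≡.sym (k![n∸k]!*nCk≡n! (ℕ.<⇒≤ k<p))) (n∣n! p)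
  p∤k![p∸k]! : ¬ p ∣ k ! ℕ.* (p ∸ k) !
  p∤k![p∸k]! p∣k![p∸k]! = [ prime∤m! p-prime k<p , prime∤m! p-prime (ℕ.∸-monoʳ-< 0<k (ℕ.<⇒≤ k<p)) ]′
    (euclidsLemma (k !) ((p ∸ k) !) p-prime p∣k![p∸k]!)

module Frobenius {c ℓ} (R : CommutativeRing c ℓ) where
  open CommutativeRing R hiding (zero)
  open import Algebra.Properties.Semiring.Mult semiring using (_×_; ×-congʳ; ×-assoc-*; ×1-homo-*)
  open import Algebra.Properties.Semiring.Exp semiring using (_^_; ^-assocʳ; ^-congˡ)
  open import Algebra.Properties.Monoid.Sum +-monoid using (sum; sum-init-last; sum-cong-≋; sum-replicate-zero)
  open import Algebra.Properties.CommutativeSemiring.Binomial commutativeSemiring using (theorem; binomialTerm)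
  open import Relation.Binary.Reasoning.Setoid setoid

  char∣m⇒m×x≈0 : ∀ {p m} → p × 1# ≈ 0# → p ∣ m → ∀ x → m × x ≈ 0#
  char∣m⇒m×x≈0 {p} char-p (divides d ≡.refl) x = begin
    (d ℕ.* p) × x                 ≈⟨ ×-congʳ (d ℕ.* p) (*-identityˡ x) ⟨
    (d ℕ.* p) × (1# * x)          ≈⟨ ×-assoc-* (d ℕ.* p) 1# x ⟨
    (d ℕ.* p) × 1# * x            ≈⟨ *-congʳ (×1-homo-* d p) ⟩
    d × 1# * (p × 1#) * x         ≈⟨ *-congʳ (*-congˡ char-p) ⟩
    d × 1# * 0# * x               ≈⟨ *-congʳ (zeroʳ _) ⟩
    0# * x                        ≈⟨ zeroˡ x ⟩
    0#                            ∎

  frobenius : ∀ {p} → Prime p → p × 1# ≈ 0# → ∀ x y → (x + y) ^ p ≈ x ^ p + y ^ p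
  frobenius {suc (suc n)} p-prime char-p x y = begin
    (x + y) ^ p
      ≈⟨ theorem p x y ⟩
    sum (binomialTerm x y p)
      ≈⟨ +-congˡ (sum-init-last (tail (binomialTerm x y p))) ⟩
    first + (sum (λ i → binomialTerm x y p (suc (Fin.inject₁ i))) + last)
      ≈⟨ +-congˡ (+-congʳ (trans (sum-cong-≋ inner) (sum-replicate-zero (suc n)))) ⟩
    first + (0# + last)
      ≈⟨ +-cong (trans (+-identityʳ _) (*-identityˡ _)) (trans (+-identityˡ last) outer) ⟩
    y ^ p + x ^ p
      ≈⟨ +-comm _ _ ⟩
    x ^ p + y ^ p ∎
    where
    p : ℕ
    p = suc (suc n)
    first last : Carrier
    first = binomialTerm x y p zero
    last = binomialTerm x y p (Fin.fromℕ p)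
    inner : ∀ i → binomialTerm x y p (suc (Fin.inject₁ i)) ≈ 0#
    inner i = char∣m⇒m×x≈0 char-p (prime∣p-choose-k p-prime (s≤s z≤n)
      (s≤s (≡.subst (ℕ._< suc n) (≡.sym (Fin.toℕ-inject₁ i)) (Fin.toℕ<n i)))) _
    lastTerm : ∀ m (j : Fin (suc m)) → toℕ j ≡ m → binomialTerm x y m j ≈ x ^ m
    lastTerm m j j≡m rewrite j≡m | nCn≡1 m | ℕ.n∸n≡0 m =
      trans (+-identityʳ _) (*-identityʳ _)
    outer : binomialTerm x y p (Fin.fromℕ p) ≈ x ^ p
    outer = lastTerm p (Fin.fromℕ p) (Fin.toℕ-fromℕ p)

  frobenius^ : ∀ {p} → Prime p → p × 1# ≈ 0# → ∀ k x y → (x + y) ^ (p ℕ.^ k) ≈ x ^ (p ℕ.^ k) + y ^ (p ℕ.^ k)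
  frobenius^ p-prime char-p zero x y = trans (*-identityʳ _) (sym (+-cong (*-identityʳ x) (*-identityʳ y)))
  frobenius^ {p} p-prime char-p (suc k) x y = begin
    (x + y) ^ (p ℕ.* p ℕ.^ k)                  ≈⟨ ^-assocʳ (x + y) p (p ℕ.^ k) ⟨
    ((x + y) ^ p) ^ (p ℕ.^ k)                  ≈⟨ ^-congˡ (p ℕ.^ k) (frobenius p-prime char-p x y) ⟩
    (x ^ p + y ^ p) ^ (p ℕ.^ k)                ≈⟨ frobenius^ p-prime char-p k (x ^ p) (y ^ p) ⟩
    (x ^ p) ^ (p ℕ.^ k) + (y ^ p) ^ (p ℕ.^ k)  ≈⟨ +-cong (^-assocʳ x p (p ℕ.^ k)) (^-assocʳ y p (p ℕ.^ k)) ⟩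
    x ^ (p ℕ.* p ℕ.^ k) + y ^ (p ℕ.* p ℕ.^ k)  ∎

module FiniteField {c ℓ} (F : CommutativeRing c ℓ) (isField : FF.IsField F) {N} (card : FF.HasCard F N) where
  open CommutativeRing F hiding (zero)
  open import Algebra.Properties.Semiring.Exp semiring using (_^_)
  open import Algebra.Properties.Semiring.Mult semiring using (_×_; ×1-homo-*)
  open import Algebra.Properties.Group +-group using (identityʳ-unique; x≈y⇒x∙y⁻¹≈ε)
  open import Data.Vec.Functional.Properties using (updateAt-updates; updateAt-minimal)
  open import Relation.Binary.Reasoning.Setoid setoid
  open IntegerRingSolver F using (solve; _:=_; _:+_; _:*_; _:-_; :-_; con)
  open FieldProperties F isField
  open FiniteSetoid setoid (proj₁ card) (proj₁ (proj₂ card)) (proj₂ (proj₂ card)) public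

  enum : Fin N → Carrier
  enum = proj₁ card

  private
    module Σ = Algebra.Properties.CommutativeMonoid.Sum +-commutativeMonoid
    module Π = Algebra.Properties.CommutativeMonoid.Sum *-commutativeMonoid

  N×1≈0 : N × 1# ≈ 0#
  N×1≈0 = identityʳ-unique (Σ.sum enum) (N × 1#) (begin
    Σ.sum enum + N × 1#                  ≈⟨ +-congˡ (Σ.sum-replicate N) ⟨
    Σ.sum enum + Σ.sum (replicate N 1#)  ≈⟨ Σ.∑-distrib-+ enum (replicate N 1#) ⟨
    Σ.sum (λ i → enum i + 1#)            ≈⟨ sum-reindex +-commutativeMonoid (λ x → x) (λ x≈y → x≈y)
                                              (_+ 1#) (_- 1#) +-congʳ +-congʳ
                                              (λ x → solve 1 (λ x → x :- con (+ 1) :+ con (+ 1) := x) refl x)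
                                              (λ x → solve 1 (λ x → x :+ con (+ 1) :- con (+ 1) := x) refl x) ⟩
    Σ.sum enum                           ∎)

  x^n≈0⇒x≈0 : ∀ {x} n → x ^ n ≈ 0# → x ≈ 0#
  x^n≈0⇒x≈0 {x} n xⁿ≈0 with x ≟ 0#
  ... | yes x≈0 = x≈0
  ... | no x≉0 = ⊥-elim (x^n≉0 n x≉0 xⁿ≈0)

  [m^n]×1≈[m×1]^n : ∀ m n → (m ℕ.^ n) × 1# ≈ (m × 1#) ^ n
  [m^n]×1≈[m×1]^n m zero = +-identityʳ 1#
  [m^n]×1≈[m×1]^n m (suc n) = trans (×1-homo-* m (m ℕ.^ n)) (*-congˡ ([m^n]×1≈[m×1]^n m n))

  [m^n]×1≈0⇒m×1≈0 : ∀ m n → (m ℕ.^ n) × 1# ≈ 0# → m × 1# ≈ 0#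
  [m^n]×1≈0⇒m×1≈0 m n mⁿ×1≈0 = x^n≈0⇒x≈0 n (trans (sym ([m^n]×1≈[m×1]^n m n)) mⁿ×1≈0)

  private
    nonzeroOr1 : Carrier → Carrier
    nonzeroOr1 y with y ≟ 0#
    ... | yes _ = 1#
    ... | no _ = y

    nonzeroOr1-≈0 : ∀ {y} → y ≈ 0# → nonzeroOr1 y ≈ 1#
    nonzeroOr1-≈0 {y} y≈0 with y ≟ 0#
    ... | yes _ = refl
    ... | no y≉0 = ⊥-elim (y≉0 y≈0)

    nonzeroOr1-≉0 : ∀ {y} → y ≉ 0# → nonzeroOr1 y ≈ y
    nonzeroOr1-≉0 {y} y≉0 with y ≟ 0#
    ... | yes y≈0 = ⊥-elim (y≉0 y≈0)
    ... | no _ = refl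

    nonzeroOr1≉0 : ∀ y → nonzeroOr1 y ≉ 0#
    nonzeroOr1≉0 y with y ≟ 0#
    ... | yes _ = 1≉0
    ... | no y≉0 = y≉0

    nonzeroOr1-cong : ∀ {x y} → x ≈ y → nonzeroOr1 x ≈ nonzeroOr1 y
    nonzeroOr1-cong {x} {y} x≈y with x ≟ 0#
    ... | yes x≈0 = sym (nonzeroOr1-≈0 (trans (sym x≈y) x≈0))
    ... | no x≉0 = trans x≈y (sym (nonzeroOr1-≉0 (λ y≈0 → x≉0 (trans x≈y y≈0))))

    ∏≉0 : ∀ {n} (f : Fin n → Carrier) → (∀ i → f i ≉ 0#) → Π.sum f ≉ 0#
    ∏≉0 {zero} f f≉0 = 1≉0
    ∏≉0 {suc n} f f≉0 = x*y≉0 (f≉0 zero) (∏≉0 (f ∘ suc) (f≉0 ∘ suc))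

    ∏-updateAt-1 : ∀ {n} (z : Fin n) x → Π.sum (updateAt (replicate n 1#) z (λ _ → x)) ≈ x
    ∏-updateAt-1 {suc n} zero x = trans (*-congˡ (Π.sum-replicate-zero n)) (*-identityʳ x)
    ∏-updateAt-1 {suc n} (suc z) x = trans (*-identityˡ _) (∏-updateAt-1 z x)

    x≈0⇒x^n≈x : ∀ {x n} → Fin n → x ≈ 0# → x ^ n ≈ x
    x≈0⇒x^n≈x {n = suc n} _ x≈0 = trans (*-congʳ x≈0) (trans (zeroˡ _) (sym x≈0))

    zeroIndex : Fin N
    zeroIndex = index 0#

    correction : Carrier → Fin N → Carrier
    correction x = updateAt (replicate N 1#) zeroIndex (λ _ → x)

    nonzeroOr1-* : ∀ {x} → x ≉ 0# → ∀ i → nonzeroOr1 (x * enum i) * correction x i ≈ x * nonzeroOr1 (enum i)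
    nonzeroOr1-* {x} x≉0 i with i Fin.≟ zeroIndex
    ... | yes ≡.refl = begin
      nonzeroOr1 (x * enum i) * correction x i    ≡⟨ ≡.cong (nonzeroOr1 (x * enum i) *_) (updateAt-updates i (replicate N 1#)) ⟩
      nonzeroOr1 (x * enum i) * x                 ≈⟨ *-congʳ (nonzeroOr1-≈0 (trans (*-congˡ (enum-index 0#)) (zeroʳ x))) ⟩
      1# * x                                      ≈⟨ *-comm 1# x ⟩
      x * 1#                                      ≈⟨ *-congˡ (nonzeroOr1-≈0 (enum-index 0#)) ⟨
      x * nonzeroOr1 (enum i)                     ∎
    ... | no i≢zeroIndex = begin
      nonzeroOr1 (x * enum i) * correction x i    ≡⟨ ≡.cong (nonzeroOr1 (x * enum i) *_) (updateAt-minimal i zeroIndex (replicate N 1#) i≢zeroIndex) ⟩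
      nonzeroOr1 (x * enum i) * 1#                ≈⟨ *-identityʳ _ ⟩
      nonzeroOr1 (x * enum i)                     ≈⟨ nonzeroOr1-≉0 (x*y≉0 x≉0 enumᵢ≉0) ⟩
      x * enum i                                  ≈⟨ *-congˡ (nonzeroOr1-≉0 enumᵢ≉0) ⟨
      x * nonzeroOr1 (enum i)                     ∎
      where
      enumᵢ≉0 : enum i ≉ 0#
      enumᵢ≉0 enumᵢ≈0 = i≢zeroIndex (≡.sym (index-unique enumᵢ≈0))

    ∏-nonzeroOr1-* : ∀ {x} → x ≉ 0# → Π.sum (λ i → nonzeroOr1 (x * enum i)) ≈ Π.sum (nonzeroOr1 ∘ enum)
    ∏-nonzeroOr1-* {x} x≉0 = sum-reindex *-commutativeMonoid nonzeroOr1 nonzeroOr1-cong (x *_) (x⁻¹ *_) *-congˡ *-congˡ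
      (λ y → trans (sym (*-assoc x x⁻¹ y)) (trans (*-congʳ x*x⁻¹≈1) (*-identityˡ y)))
      (λ y → trans (sym (*-assoc x⁻¹ x y)) (trans (*-congʳ (trans (*-comm x⁻¹ x) x*x⁻¹≈1)) (*-identityˡ y)))
      where
      x⁻¹ : Carrier
      x⁻¹ = proj₁ (proj₂ isField x x≉0)
      x*x⁻¹≈1 : x * x⁻¹ ≈ 1#
      x*x⁻¹≈1 = proj₂ (proj₂ isField x x≉0)

  -- Multiplication by a unit x permutes the field, so the product P of the nonzero elements
  -- satisfies P x = x^N P, the factor x standing in for the image of 0.
  x^N≈x : ∀ x → x ^ N ≈ x
  x^N≈x x with x ≟ 0#
  ... | yes x≈0 = x≈0⇒x^n≈x zeroIndex x≈0
  ... | no x≉0 = sym (*-cancelˡ P≉0 (begin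
    P * x                                                         ≈⟨ *-cong (sym (∏-nonzeroOr1-* x≉0)) (sym (∏-updateAt-1 zeroIndex x)) ⟩
    Π.sum (λ i → nonzeroOr1 (x * enum i)) * Π.sum (correction x)  ≈⟨ Π.∑-distrib-+ _ (correction x) ⟨
    Π.sum (λ i → nonzeroOr1 (x * enum i) * correction x i)        ≈⟨ Π.sum-cong-≋ (nonzeroOr1-* x≉0) ⟩
    Π.sum (λ i → x * nonzeroOr1 (enum i))                         ≈⟨ Π.∑-distrib-+ (replicate N x) (nonzeroOr1 ∘ enum) ⟩
    Π.sum (replicate N x) * P                                     ≈⟨ *-congʳ (Π.sum-replicate N) ⟩
    x ^ N * P                                                     ≈⟨ *-comm _ P ⟩
    P * x ^ N                                                     ∎))
    where
    P : Carrier
    P = Π.sum (nonzeroOr1 ∘ enum)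
    P≉0 : P ≉ 0#
    P≉0 = ∏≉0 (nonzeroOr1 ∘ enum) (nonzeroOr1≉0 ∘ enum)

  x^q≈x-for-all⇒N≤q : ∀ q → 2 ≤ q → (∀ x → x ^ q ≈ x) → N ≤ q
  x^q≈x-for-all⇒N≤q (suc (suc r)) (s≤s (s≤s z≤n)) all-fixed = distinctRoots≤degree
    (0# ∷ - 1# ∷ replicate r 0#) enum (proj₁ (proj₂ card)) (λ i → begin
      evalMonic (0# ∷ - 1# ∷ replicate r 0#) (enum i)   ≈⟨ evalMonic-Xq-X (enum i) ⟩
      enum i ^ suc (suc r) - enum i                      ≈⟨ x≈y⇒x∙y⁻¹≈ε (all-fixed (enum i)) ⟩
      0#                                                 ∎)
    where
    evalMonic-0s : ∀ n x → evalMonic (replicate n 0#) x ≈ x ^ n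
    evalMonic-0s zero x = refl
    evalMonic-0s (suc n) x = trans (+-identityˡ _) (*-congˡ (evalMonic-0s n x))
    evalMonic-Xq-X : ∀ x → evalMonic (0# ∷ - 1# ∷ replicate r 0#) x ≈ x ^ suc (suc r) - x
    evalMonic-Xq-X x = trans (+-congˡ (*-congˡ (+-congˡ (*-congˡ (evalMonic-0s r x)))))
      (solve 2 (λ x w → con (+ 0) :+ x :* (:- con (+ 1) :+ x :* w) := x :* (x :* w) :- x) refl x (x ^ r))

module DicksonCriterion {c ℓ} (F : CommutativeRing c ℓ) (isField : FF.IsField F)
  (σ : CommutativeRing.Carrier F → CommutativeRing.Carrier F)
  (σ-isRingHomomorphism : RingMorphisms.IsRingHomomorphism (CommutativeRing.rawRing F) (CommutativeRing.rawRing F) σ)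
  (σ³≈id : ∀ x → CommutativeRing._≈_ F (σ (σ (σ x))) x) where
  open CommutativeRing F hiding (zero)
  open RingMorphisms.IsRingHomomorphism σ-isRingHomomorphism
    using (⟦⟧-cong; +-homo; *-homo; -‿homo; 0#-homo; 1#-homo)
  open import Algebra.Properties.Semiring.Exp semiring using (_^_)
  open import Algebra.Properties.Group +-group using (x∙y⁻¹≈ε⇒x≈y; x≈y⇒x∙y⁻¹≈ε)
  open import Relation.Binary.Reasoning.Setoid setoid
  open Matrix3 rawRing hiding (_-_)
  open Matrix3Properties F
  open FieldProperties F isField

  orbit : Carrier → Vector Carrier 3
  orbit z = z ∷ σ z ∷ σ (σ z) ∷ []

  dickson : Vector Carrier 3 → Matrix
  dickson a = dicksonMatrix a (σ ∘ a) (σ ∘ σ ∘ a)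

  σ-^ : ∀ x n → σ (x ^ n) ≈ σ x ^ n
  σ-^ x zero = 1#-homo
  σ-^ x (suc n) = trans (*-homo x (x ^ n)) (*-congˡ (σ-^ x n))

  σ-∙ : ∀ u v → σ (u ∙ v) ≈ (σ ∘ u) ∙ (σ ∘ v)
  σ-∙ u v = trans (+-homo _ _) (+-cong (trans (+-homo _ _) (+-cong (*-homo _ _) (*-homo _ _))) (*-homo _ _))

  σ-orbit : ∀ z i → σ (orbit z i) ≈ rotate (orbit z) i
  σ-orbit z zero = refl
  σ-orbit z (suc zero) = refl
  σ-orbit z (suc (suc zero)) = σ³≈id z

  orbit-cong : ∀ {x y} → x ≈ y → ∀ i → orbit x i ≈ orbit y i
  orbit-cong x≈y zero = x≈y
  orbit-cong x≈y (suc zero) = ⟦⟧-cong x≈y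
  orbit-cong x≈y (suc (suc zero)) = ⟦⟧-cong (⟦⟧-cong x≈y)

  orbit-^ : ∀ x n i → orbit (x ^ n) i ≈ orbit x i ^ n
  orbit-^ x n zero = refl
  orbit-^ x n (suc zero) = σ-^ x n
  orbit-^ x n (suc (suc zero)) = trans (⟦⟧-cong (σ-^ x n)) (σ-^ (σ x) n)

  σ-- : ∀ x y → σ (x - y) ≈ σ x - σ y
  σ-- x y = trans (+-homo x (- y)) (+-congˡ (-‿homo y))

  orbit-+ : ∀ x y i → orbit (x + y) i ≈ zipWith _+_ (orbit x) (orbit y) i
  orbit-+ x y zero = refl
  orbit-+ x y (suc zero) = +-homo x y
  orbit-+ x y (suc (suc zero)) = trans (⟦⟧-cong (+-homo x y)) (+-homo (σ x) (σ y))

  orbit-- : ∀ x y i → orbit (x - y) i ≈ zipWith _-_ (orbit x) (orbit y) i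
  orbit-- x y zero = refl
  orbit-- x y (suc zero) = σ-- x y
  orbit-- x y (suc (suc zero)) = trans (⟦⟧-cong (σ-- x y)) (σ-- (σ x) (σ y))

  orbit-0 : ∀ i → orbit 0# i ≈ 0#
  orbit-0 zero = refl
  orbit-0 (suc zero) = 0#-homo
  orbit-0 (suc (suc zero)) = trans (⟦⟧-cong 0#-homo) 0#-homo

  σ-∙-orbit : ∀ a z → σ (a ∙ orbit z) ≈ rotate (rotate (σ ∘ a)) ∙ orbit z
  σ-∙-orbit a z = begin
    σ (a ∙ orbit z)                         ≈⟨ σ-∙ a (orbit z) ⟩
    (σ ∘ a) ∙ (σ ∘ orbit z)                 ≈⟨ ∙-cong {u = σ ∘ a} (λ _ → refl) (σ-orbit z) ⟩
    (σ ∘ a) ∙ rotate (orbit z)              ≈⟨ ∙-rotate (σ ∘ a) (orbit z) ⟩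
    rotate (rotate (σ ∘ a)) ∙ orbit z       ∎

  dickson-*ᵥ-orbit : ∀ a z i → (dickson a *ᵥ orbit z) i ≈ orbit (a ∙ orbit z) i
  dickson-*ᵥ-orbit a z zero = refl
  dickson-*ᵥ-orbit a z (suc zero) = sym (σ-∙-orbit a z)
  dickson-*ᵥ-orbit a z (suc (suc zero)) =
    sym (trans (⟦⟧-cong (σ-∙-orbit a z)) (σ-∙-orbit (rotate (rotate (σ ∘ a))) z))

  dickson-injective : ∀ a → det (dickson a) ≉ 0# → ∀ x y → a ∙ orbit x ≈ a ∙ orbit y → x ≈ y
  dickson-injective a det≉0 x y a∙orbit≈ = x∙y⁻¹≈ε⇒x≈y x y (x≉0∧x*y≈0⇒y≈0 det≉0
    (det-kernel (dickson a) (orbit (x - y)) (λ i → begin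
      (dickson a *ᵥ orbit (x - y)) i                     ≈⟨ dickson-*ᵥ-orbit a (x - y) i ⟩
      orbit (a ∙ orbit (x - y)) i                        ≈⟨ orbit-cong a∙orbit[x-y]≈0 i ⟩
      orbit 0# i                                         ≈⟨ orbit-0 i ⟩
      0#                                                 ∎)))
    where
    a∙orbit[x-y]≈0 : a ∙ orbit (x - y) ≈ 0#
    a∙orbit[x-y]≈0 = begin
      a ∙ orbit (x - y)                                  ≈⟨ ∙-cong {u = a} (λ _ → refl) (orbit-- x y) ⟩
      a ∙ zipWith _-_ (orbit x) (orbit y)                ≈⟨ ∙-distribˡ-- a (orbit x) (orbit y) ⟩
      a ∙ orbit x - a ∙ orbit y                          ≈⟨ x≈y⇒x∙y⁻¹≈ε a∙orbit≈ ⟩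
      0#                                                 ∎

  dickson-det≉0 : ∀ a → (∀ y → ∃ λ x → a ∙ orbit x ≈ y) → ∀ μ → σ μ ≉ μ → det (dickson a) ≉ 0#
  dickson-det≉0 a surjective μ σμ≉μ det≈0 = vandermonde≉0 (begin
    (σ μ - μ) * (σ (σ μ) - μ) * (σ (σ μ) - σ μ)   ≈⟨ det-vandermonde (orbit μ) ⟨
    det (vandermonde (orbit μ))                   ≈⟨ det-cong DX≈V ⟨
    det (dickson a *ₘ X)                          ≈⟨ det-*ₘ (dickson a) X ⟩
    det (dickson a) * det X                       ≈⟨ *-congʳ det≈0 ⟩
    0# * det X                                    ≈⟨ zeroˡ (det X) ⟩
    0#                                            ∎)
    where
    x : Fin 3 → Carrier
    x j = proj₁ (surjective (μ ^ toℕ j))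
    X : Matrix
    X i j = orbit (x j) i
    DX≈V : ∀ i j → (dickson a *ₘ X) i j ≈ vandermonde (orbit μ) i j
    DX≈V i j = begin
      (dickson a *ᵥ orbit (x j)) i     ≈⟨ dickson-*ᵥ-orbit a (x j) i ⟩
      orbit (a ∙ orbit (x j)) i        ≈⟨ orbit-cong (proj₂ (surjective (μ ^ toℕ j))) i ⟩
      orbit (μ ^ toℕ j) i              ≈⟨ orbit-^ μ (toℕ j) i ⟩
      orbit μ i ^ toℕ j                ∎
    σσμ≉μ : σ (σ μ) ≉ μ
    σσμ≉μ σσμ≈μ = σμ≉μ (trans (sym (⟦⟧-cong σσμ≈μ)) (σ³≈id μ))
    σσμ≉σμ : σ (σ μ) ≉ σ μ
    σσμ≉σμ σσμ≈σμ = σμ≉μ (sym (trans (sym (σ³≈id μ)) (trans (⟦⟧-cong σσμ≈σμ) σσμ≈σμ)))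
    vandermonde≉0 : (σ μ - μ) * (σ (σ μ) - μ) * (σ (σ μ) - σ μ) ≉ 0#
    vandermonde≉0 = x*y≉0 (x*y≉0 (σμ≉μ ∘ x∙y⁻¹≈ε⇒x≈y _ _) (σσμ≉μ ∘ x∙y⁻¹≈ε⇒x≈y _ _))
                          (σσμ≉σμ ∘ x∙y⁻¹≈ε⇒x≈y _ _)

module CubicFrobenius {c ℓ} (F : CommutativeRing c ℓ) (isField : FF.IsField F)
  {p} (p-prime : Prime p) (k : ℕ) (2≤q : 2 ≤ p ℕ.^ k) (card : FF.HasCard F ((p ℕ.^ k) ℕ.^ 3)) where
  open CommutativeRing F hiding (zero)
  open import Algebra.Properties.Semiring.Exp semiring using (_^_; ^-congˡ; ^-assocʳ)
  open import Algebra.Properties.CommutativeSemiring.Exp commutativeSemiring using (^-distrib-*)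
  open import Algebra.Properties.Semiring.Mult semiring using (_×_)
  open import Algebra.Properties.Group +-group using (inverseˡ-unique)
  open import Relation.Binary.Reasoning.Setoid setoid
  open FiniteField F isField card
  open Frobenius F using (frobenius^)

  q : ℕ
  q = p ℕ.^ k

  σ : Carrier → Carrier
  σ x = x ^ q

  char-p : p × 1# ≈ 0#
  char-p = [m^n]×1≈0⇒m×1≈0 p k ([m^n]×1≈0⇒m×1≈0 q 3 N×1≈0)

  σ-isRingHomomorphism : RingMorphisms.IsRingHomomorphism rawRing rawRing σ
  σ-isRingHomomorphism = record
    { isSemiringHomomorphism = record
      { isNearSemiringHomomorphism = record
        { +-isMonoidHomomorphism = record
          { isMagmaHomomorphism = record
            { isRelHomomorphism = record { cong = ^-congˡ q }
            ; homo = frobenius^ p-prime char-p k }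
          ; ε-homo = 0^n≈0 (ℕ.<⇒≤ 2≤q) }
        ; *-homo = λ x y → ^-distrib-* x y q }
      ; 1#-homo = 1^n≈1 q }
    ; -‿homo = σ-neg }
    where
    0^n≈0 : ∀ {n} → 1 ≤ n → 0# ^ n ≈ 0#
    0^n≈0 (s≤s _) = zeroˡ _
    1^n≈1 : ∀ n → 1# ^ n ≈ 1#
    1^n≈1 zero = refl
    1^n≈1 (suc n) = trans (*-identityˡ _) (1^n≈1 n)
    σ-neg : ∀ x → σ (- x) ≈ - σ x
    σ-neg x = inverseˡ-unique (σ (- x)) (σ x) (begin
      σ (- x) + σ x   ≈⟨ frobenius^ p-prime char-p k (- x) x ⟨
      σ (- x + x)     ≈⟨ ^-congˡ q (-‿inverseˡ x) ⟩
      σ 0#            ≈⟨ 0^n≈0 (ℕ.<⇒≤ 2≤q) ⟩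
      0#              ∎)

  σ³≈id : ∀ x → σ (σ (σ x)) ≈ x
  σ³≈id x = begin
    σ (σ (σ x))                ≈⟨ ^-congˡ q (^-assocʳ x q q) ⟩
    (x ^ (q ℕ.* q)) ^ q        ≈⟨ ^-assocʳ x (q ℕ.* q) q ⟩
    x ^ (q ℕ.* q ℕ.* q)        ≡⟨ ≡.cong (x ^_) q*q*q≡q^3 ⟩
    x ^ (q ℕ.^ 3)              ≈⟨ x^N≈x x ⟩
    x                          ∎
    where
    q*q*q≡q^3 : q ℕ.* q ℕ.* q ≡ q ℕ.^ 3
    q*q*q≡q^3 = ≡.trans (ℕ.*-assoc q q q) (≡.cong (λ m → q ℕ.* (q ℕ.* m)) (≡.sym (ℕ.*-identityʳ q)))

  σ≉id : ¬ (∀ x → σ x ≈ x)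
  σ≉id all-fixed = ℕ.<⇒≱ q<q³ (x^q≈x-for-all⇒N≤q q 2≤q all-fixed)
    where
    q<q³ : q < q ℕ.^ 3
    q<q³ = ≡.subst (ℕ._< q ℕ.^ 3) (ℕ.^-identityʳ q) (ℕ.^-monoʳ-< q 2≤q {1} {3} (s≤s (s≤s z≤n)))

module PlanarityCriterion {c ℓ} (F : CommutativeRing c ℓ) (isField : FF.IsField F)
  {p} (p-prime : Prime p) (k : ℕ) (2≤q : 2 ≤ p ℕ.^ k) (card : FF.HasCard F ((p ℕ.^ k) ℕ.^ 3))
  (E A B C D : CommutativeRing.Carrier F)
  (E-fixed : FF.InSubfield F (p ℕ.^ k) E) (A-fixed : FF.InSubfield F (p ℕ.^ k) A)
  (B-fixed : FF.InSubfield F (p ℕ.^ k) B) (C-fixed : FF.InSubfield F (p ℕ.^ k) C)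
  (D-fixed : FF.InSubfield F (p ℕ.^ k) D) where
  open CommutativeRing F hiding (zero)
  open import Algebra.Properties.Semiring.Exp semiring using (_^_; ^-congˡ; ^-assocʳ; ^-homo-*)
  open import Algebra.Properties.Group +-group using (∙-cancelʳ)
  open import Data.Nat.Tactic.RingSolver using (solve-∀)
  open import Relation.Binary.Reasoning.Setoid setoid
  open Matrix3 rawRing using (_∙_; det; dicksonMatrix)
  open Matrix3Properties F using (∙-cong; rotate-cong; dicksonMatrix-cong; det-cong)
  open PlanarityPolynomials rawRing E A B C D
  open PlanarityIdentities F E A B C D
  open CubicFrobenius F isField p-prime k 2≤q card
  open RingMorphisms.IsRingHomomorphism σ-isRingHomomorphism using (⟦⟧-cong; +-homo; *-homo)
  open DicksonCriterion F isField σ σ-isRingHomomorphism σ³≈id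
  open FiniteField F isField card using (_≟_; injective⇒surjective)

  f : Carrier → Carrier
  f = FF.fEABCD F q E A B C D

  Expr : Carrier → Carrier
  Expr = FF.Expr F q E A B C D

  ^≈monomial : ∀ x {e} i j l → e ≡ i ℕ.+ q ℕ.* j ℕ.+ q ℕ.* q ℕ.* l → x ^ e ≈ monomial i j l (orbit x)
  ^≈monomial x i j l ≡.refl = begin
    x ^ (i ℕ.+ q ℕ.* j ℕ.+ q ℕ.* q ℕ.* l)        ≈⟨ ^-homo-* x (i ℕ.+ q ℕ.* j) (q ℕ.* q ℕ.* l) ⟩
    x ^ (i ℕ.+ q ℕ.* j) * x ^ (q ℕ.* q ℕ.* l)    ≈⟨ *-congʳ (^-homo-* x i (q ℕ.* j)) ⟩
    x ^ i * x ^ (q ℕ.* j) * x ^ (q ℕ.* q ℕ.* l)  ≈⟨ *-cong (*-congˡ (^-assocʳ x q j)) σσx^l≈ ⟨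
    x ^ i * σ x ^ j * σ (σ x) ^ l                ∎
    where
    σσx^l≈ : σ (σ x) ^ l ≈ x ^ (q ℕ.* q ℕ.* l)
    σσx^l≈ = trans (^-congˡ l (^-assocʳ x q q)) (^-assocʳ x (q ℕ.* q) l)

  f≈quadratic∘orbit : ∀ x → f x ≈ quadratic (orbit x)
  f≈quadratic∘orbit x = +-cong (+-cong (+-cong (+-cong
      (*-congˡ (^≈monomial x 2 0 0 (e₂₀₀ q)))
      (*-congˡ (^≈monomial x 1 1 0 (e₁₁₀ q))))
      (*-congˡ (^≈monomial x 1 0 1 (e₁₀₁ q))))
      (*-congˡ (^≈monomial x 0 2 0 (e₀₂₀ q))))
      (*-congˡ (^≈monomial x 0 0 2 (e₀₀₂ q)))
    where
    e₂₀₀ : ∀ n → 2 ≡ 2 ℕ.+ n ℕ.* 0 ℕ.+ n ℕ.* n ℕ.* 0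
    e₂₀₀ = solve-∀
    e₁₁₀ : ∀ n → n ℕ.+ 1 ≡ 1 ℕ.+ n ℕ.* 1 ℕ.+ n ℕ.* n ℕ.* 0
    e₁₁₀ = solve-∀
    e₁₀₁ : ∀ n → n ℕ.* n ℕ.+ 1 ≡ 1 ℕ.+ n ℕ.* 0 ℕ.+ n ℕ.* n ℕ.* 1
    e₁₀₁ = solve-∀
    e₀₂₀ : ∀ n → 2 ℕ.* n ≡ 0 ℕ.+ n ℕ.* 2 ℕ.+ n ℕ.* n ℕ.* 0
    e₀₂₀ = solve-∀
    e₀₀₂ : ∀ n → 2 ℕ.* (n ℕ.* n) ≡ 0 ℕ.+ n ℕ.* 0 ℕ.+ n ℕ.* n ℕ.* 2
    e₀₀₂ = solve-∀

  Expr≈dicksonDeterminant∘orbit : ∀ ε → Expr ε ≈ dicksonDeterminant (orbit ε)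
  Expr≈dicksonDeterminant∘orbit ε = +-cong (+-cong (+-cong
      (*-congˡ (+-cong (+-cong (m 3 0 0 (e₃₀₀ q)) (m 0 3 0 (e₀₃₀ q))) (m 0 0 3 (e₀₀₃ q))))
      (*-congˡ (+-cong (+-cong (m 2 1 0 (e₂₁₀ q)) (m 1 0 2 (e₁₀₂ q))) (m 0 2 1 (e₀₂₁ q)))))
      (*-congˡ (+-cong (+-cong (m 2 0 1 (e₂₀₁ q)) (m 1 2 0 (e₁₂₀ q))) (m 0 1 2 (e₀₁₂ q)))))
      (*-congˡ (m 1 1 1 (e₁₁₁ q)))
    where
    m : ∀ {e} i j l → e ≡ i ℕ.+ q ℕ.* j ℕ.+ q ℕ.* q ℕ.* l → ε ^ e ≈ monomial i j l (orbit ε)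
    m = ^≈monomial ε
    e₃₀₀ : ∀ n → 3 ≡ 3 ℕ.+ n ℕ.* 0 ℕ.+ n ℕ.* n ℕ.* 0
    e₃₀₀ = solve-∀
    e₀₃₀ : ∀ n → 3 ℕ.* n ≡ 0 ℕ.+ n ℕ.* 3 ℕ.+ n ℕ.* n ℕ.* 0
    e₀₃₀ = solve-∀
    e₀₀₃ : ∀ n → 3 ℕ.* (n ℕ.* n) ≡ 0 ℕ.+ n ℕ.* 0 ℕ.+ n ℕ.* n ℕ.* 3
    e₀₀₃ = solve-∀
    e₂₁₀ : ∀ n → 2 ℕ.+ n ≡ 2 ℕ.+ n ℕ.* 1 ℕ.+ n ℕ.* n ℕ.* 0
    e₂₁₀ = solve-∀
    e₁₀₂ : ∀ n → 1 ℕ.+ 2 ℕ.* (n ℕ.* n) ≡ 1 ℕ.+ n ℕ.* 0 ℕ.+ n ℕ.* n ℕ.* 2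
    e₁₀₂ = solve-∀
    e₀₂₁ : ∀ n → 2 ℕ.* n ℕ.+ n ℕ.* n ≡ 0 ℕ.+ n ℕ.* 2 ℕ.+ n ℕ.* n ℕ.* 1
    e₀₂₁ = solve-∀
    e₂₀₁ : ∀ n → 2 ℕ.+ n ℕ.* n ≡ 2 ℕ.+ n ℕ.* 0 ℕ.+ n ℕ.* n ℕ.* 1
    e₂₀₁ = solve-∀
    e₁₂₀ : ∀ n → 1 ℕ.+ 2 ℕ.* n ≡ 1 ℕ.+ n ℕ.* 2 ℕ.+ n ℕ.* n ℕ.* 0
    e₁₂₀ = solve-∀
    e₀₁₂ : ∀ n → n ℕ.+ 2 ℕ.* (n ℕ.* n) ≡ 0 ℕ.+ n ℕ.* 1 ℕ.+ n ℕ.* n ℕ.* 2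
    e₀₁₂ = solve-∀
    e₁₁₁ : ∀ n → 1 ℕ.+ n ℕ.+ n ℕ.* n ≡ 1 ℕ.+ n ℕ.* 1 ℕ.+ n ℕ.* n ℕ.* 1
    e₁₁₁ = solve-∀

  σ-fixed-+ : ∀ {a b} → σ a ≈ a → σ b ≈ b → σ (a + b) ≈ a + b
  σ-fixed-+ σa≈a σb≈b = trans (+-homo _ _) (+-cong σa≈a σb≈b)

  σ-fixed-* : ∀ {a} x → σ a ≈ a → σ (a * x) ≈ a * σ x
  σ-fixed-* x σa≈a = trans (*-homo _ x) (*-congʳ σa≈a)

  σ-linearPart : ∀ v i → σ (linearPart v i) ≈ linearPart (σ ∘ v) i
  σ-linearPart v zero = σ-+₃ (σ-fixed-* _ (σ-fixed-+ E-fixed E-fixed)) (σ-fixed-* _ A-fixed) (σ-fixed-* _ B-fixed)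
    where
    σ-+₃ : ∀ {x y z x′ y′ z′} → σ x ≈ x′ → σ y ≈ y′ → σ z ≈ z′ → σ (x + y + z) ≈ x′ + y′ + z′
    σ-+₃ x y z = trans (+-homo _ _) (+-cong (trans (+-homo _ _) (+-cong x y)) z)
  σ-linearPart v (suc zero) =
    trans (+-homo _ _) (+-cong (σ-fixed-* _ A-fixed) (σ-fixed-* _ (σ-fixed-+ C-fixed C-fixed)))
  σ-linearPart v (suc (suc zero)) =
    trans (+-homo _ _) (+-cong (σ-fixed-* _ B-fixed) (σ-fixed-* _ (σ-fixed-+ D-fixed D-fixed)))

  -- σ fixes the coefficients of linearPart and rotates the orbit of ε.
  dickson≈dicksonMatrix : ∀ ε i j →
    let v = orbit ε in
    dickson (linearPart v) i j ≈ dicksonMatrix (linearPart v) (linearPart (rotate v)) (linearPart (rotate (rotate v))) i j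
  dickson≈dicksonMatrix ε = dicksonMatrix-cong (λ _ → refl) σc≈ σσc≈
    where
    v : Vector Carrier 3
    v = orbit ε
    σc≈ : ∀ i → σ (linearPart v i) ≈ linearPart (rotate v) i
    σc≈ i = trans (σ-linearPart v i) (linearPart-cong (σ-orbit ε) i)
    σσc≈ : ∀ i → σ (σ (linearPart v i)) ≈ linearPart (rotate (rotate v)) i
    σσc≈ i = trans (⟦⟧-cong (σc≈ i)) (trans (σ-linearPart (rotate v) i) (linearPart-cong (rotate-cong (σ-orbit ε)) i))

  Expr≈det∘dickson : ∀ ε → Expr ε ≈ det (dickson (linearPart (orbit ε)))
  Expr≈det∘dickson ε = begin
    Expr ε                                           ≈⟨ Expr≈dicksonDeterminant∘orbit ε ⟩
    dicksonDeterminant (orbit ε)                     ≈⟨ det-dicksonMatrix-linearPart (orbit ε) ⟨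
    det (dicksonMatrix (linearPart v) (linearPart (rotate v)) (linearPart (rotate (rotate v))))
                                                     ≈⟨ det-cong (dickson≈dicksonMatrix ε) ⟨
    det (dickson (linearPart (orbit ε)))             ∎
    where
    v : Vector Carrier 3
    v = orbit ε

  difference≈ : ∀ ε x → f (x + ε) - f x ≈ linearPart (orbit ε) ∙ orbit x + quadratic (orbit ε)
  difference≈ ε x = begin
    f (x + ε) - f x                                                     ≈⟨ +-cong (f≈quadratic∘orbit (x + ε)) (-‿cong (f≈quadratic∘orbit x)) ⟩
    quadratic (orbit (x + ε)) - quadratic (orbit x)                     ≈⟨ +-congʳ (quadratic-cong (orbit-+ x ε)) ⟩
    quadratic (zipWith _+_ (orbit x) (orbit ε)) - quadratic (orbit x)   ≈⟨ quadratic-difference (orbit x) (orbit ε) ⟩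
    linearPart (orbit ε) ∙ orbit x + quadratic (orbit ε)                ∎

  Expr≉0⇒planar : (∀ ε → ε ≉ 0# → Expr ε ≉ 0#) → FF.IsPlanar F f
  Expr≉0⇒planar Expr≉0 ε ε≉0 = Δ-injective , injective⇒surjective Δ Δ-cong Δ-injective
    where
    Δ : Carrier → Carrier
    Δ x = f (x + ε) - f x
    det≉0 : det (dickson (linearPart (orbit ε))) ≉ 0#
    det≉0 det≈0 = Expr≉0 ε ε≉0 (trans (Expr≈det∘dickson ε) det≈0)
    Δ-injective : ∀ x y → Δ x ≈ Δ y → x ≈ y
    Δ-injective x y Δx≈Δy = dickson-injective (linearPart (orbit ε)) det≉0 x y
      (∙-cancelʳ (quadratic (orbit ε)) _ _ (trans (sym (difference≈ ε x)) (trans Δx≈Δy (difference≈ ε y))))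
    Δ-cong : ∀ {x y} → x ≈ y → Δ x ≈ Δ y
    Δ-cong {x} {y} x≈y = begin
      Δ x                                                   ≈⟨ difference≈ ε x ⟩
      linearPart (orbit ε) ∙ orbit x + quadratic (orbit ε)  ≈⟨ +-congʳ (∙-cong {u = linearPart (orbit ε)} (λ _ → refl) (orbit-cong x≈y)) ⟩
      linearPart (orbit ε) ∙ orbit y + quadratic (orbit ε)  ≈⟨ difference≈ ε y ⟨
      Δ y                                                   ∎

  planar⇒Expr≉0 : FF.IsPlanar F f → ∀ ε → ε ≉ 0# → Expr ε ≉ 0#
  planar⇒Expr≉0 planar ε ε≉0 Expr≈0 = σ≉id σ-fixes-everything
    where
    L-surjective : ∀ y → ∃ λ x → linearPart (orbit ε) ∙ orbit x ≈ y
    L-surjective y with proj₂ (planar ε ε≉0) (y + quadratic (orbit ε))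
    ... | x , Δx≈y+K = x , ∙-cancelʳ (quadratic (orbit ε)) (linearPart (orbit ε) ∙ orbit x) y (trans (sym (difference≈ ε x)) Δx≈y+K)
    σ-fixes-everything : ∀ μ → σ μ ≈ μ
    σ-fixes-everything μ with σ μ ≟ μ
    ... | yes σμ≈μ = σμ≈μ
    ... | no σμ≉μ = ⊥-elim (dickson-det≉0 (linearPart (orbit ε)) L-surjective μ σμ≉μ (trans (sym (Expr≈det∘dickson ε)) Expr≈0))

  planar⇔Expr≉0 : FF.IsPlanar F f ⇔ (∀ ε → ε ≉ 0# → Expr ε ≉ 0#)
  planar⇔Expr≉0 = mk⇔ planar⇒Expr≉0 Expr≉0⇒planar

prime^k≥2 : ∀ {p k} → Prime p → 1 ≤ k → 2 ≤ p ℕ.^ k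
prime^k≥2 {p} {k} p-prime 1≤k =
  ℕ.≤-trans (ℕ.nonTrivial⇒n>1 p) (≡.subst (_≤ p ℕ.^ k) (ℕ.^-identityʳ p) (ℕ.^-monoʳ-≤ p 1≤k))
  where
  instance
    p-nonTrivial : ℕ.NonTrivial p
    p-nonTrivial = prime⇒nonTrivial p-prime
    p-nonZero : ℕ.NonZero p
    p-nonZero = ℕ.nonTrivial⇒nonZero p

-- Imported only here: the modules above use the ring's _^_.
open import Data.Nat using (_^_)

proposition2p1 : ∀ {c ℓ} (F : CommutativeRing c ℓ) (p k : ℕ) → Prime p → p ≢ 2 → 1 ≤ k →
    FF.IsField F → FF.HasCard F ((p ^ k) ^ 3) →
    (A B C D E : CommutativeRing.Carrier F) →
    FF.InSubfield F (p ^ k) A → FF.InSubfield F (p ^ k) B → FF.InSubfield F (p ^ k) C →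
    FF.InSubfield F (p ^ k) D → FF.InSubfield F (p ^ k) E →
    FF.NotAllZero F E A B C D →
    (FF.IsPlanar F (FF.fEABCD F (p ^ k) E A B C D)
      ⇔ (∀ ε → ¬ (CommutativeRing._≈_ F ε (CommutativeRing.0# F)) →
           ¬ (CommutativeRing._≈_ F (FF.Expr F (p ^ k) E A B C D ε) (CommutativeRing.0# F))))
proposition2p1 F p k p-prime _ 1≤k isField card A B C D E A-fixed B-fixed C-fixed D-fixed E-fixed _ =
  PlanarityCriterion.planar⇔Expr≉0 F isField p-prime k (prime^k≥2 p-prime 1≤k) card
    E A B C D E-fixed A-fixed B-fixed C-fixed D-fixed
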